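{- Let $m\geq 2$ and $n\geq 2$ be integers, let $T_m$ be a tree of order $m$ and let $K_n$ be the complete graph of order $n$. Then $$\max\{rvc(T_m),\, n+2\}\leq rvcl(T_m \diamond K_n)\leq 2m+n-2.$$
   Context: All graphs are finite, simple, connected and undirected; $d(\cdot,\cdot)$ is the graph distance. For $k\in\mathbb{N}$, a rainbow vertex $k$-coloring of $G$ is a function $c: V(G)\to\{1,\dots,k\}$ such that every two vertices $u,v$ are joined by a $u$–$v$ path whose internal vertices have pairwise distinct colors; $rvc(G)$ is the smallest positive integer $k$ for which such a coloring exists. For a rainbow vertex $k$-coloring $c$ (using all $k$ colors), let $R_i$ be the set of vertices of color $i$ and $\Pi=(R_1,\dots,R_k)$; the rainbow code of $v$ is $rc_\Pi(v)=(d(v,R_1),\dots,d(v,R_k))$, where $d(v,R_i)=\min_{x\in R_i} d(v,x)$. The coloring is a locating rainbow $k$-coloring if all vertices have pairwise distinct rainbow codes; $rvcl(G)$ is the smallest positive integer $k$ such that $G$ has a locating rainbow $k$-coloring. The edge corona $G\diamond H$ is obtained from one copy of $G$ and $|E(G)|$ copies of $H$, where, enumerating the edges of $G$ as $e_1,\dots,e_{|E(G)|}$, both end vertices of $e_j$ are joined to every vertex of the $j$-th copy of $H$. -}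

module Defs where

open import Data.Nat using (ℕ; zero; suc; _≤_; _<_)
open import Data.Fin using (Fin; toℕ)
open import Data.Fin.Properties using (_≟_)
open import Data.Bool using (Bool; true; false; _∧_; _∨_; not)
open import Data.Bool.Properties using (∧-comm)
open import Data.Sum using (_⊎_; inj₁; inj₂)
open import Data.Product using (Σ; ∃; _×_; _,_; proj₁; proj₂)
open import Data.List using (List; []; _∷_; _++_; map; length)
open import Data.List.Relation.Unary.Linked using (Linked)
open import Data.List.Relation.Unary.Unique.Propositional using (Unique)
open import Relation.Nullary using (¬_; yes; no)
open import Relation.Nullary.Decidable using (⌊_⌋)
open import Relation.Binary.PropositionalEquality using (_≡_; _≢_; refl; sym; cong₂)

record Graph (V : Set) : Set where
  field
    adj     : V → V → Bool
    adj-sym : ∀ u v → adj u v ≡ adj v u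
    adj-irr : ∀ v → adj v v ≡ false

open Graph public

module _ {V : Set} (G : Graph V) where

  Adj : V → V → Set
  Adj u v = adj G u v ≡ true

  data Walk : V → V → ℕ → Set where
    here : ∀ {u} → Walk u u 0
    step : ∀ {u w v k} → Adj u w → Walk w v k → Walk u v (suc k)

  Connected : Set
  Connected = ∀ u v → ∃ λ k → Walk u v k

  IsCycle : V → List V → Set
  IsCycle x rest =
    2 ≤ length rest × Unique (x ∷ rest) × Linked Adj (x ∷ rest ++ x ∷ [])

  Acyclic : Set
  Acyclic = ∀ x rest → ¬ IsCycle x rest

  IsTree : Set
  IsTree = Connected × Acyclic

  DistTo : V → (V → Set) → ℕ → Set
  DistTo v P k =
    (∃ λ x → P x × Walk v x k) × (∀ x j → P x → Walk v x j → k ≤ j)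

  IsRainbow : ∀ {k} → (V → Fin k) → Set
  IsRainbow c = ∀ u v → u ≢ v → ∃ λ (is : List V) →
    Linked Adj (u ∷ is ++ v ∷ []) × Unique (u ∷ is ++ v ∷ []) × Unique (map c is)

  Surjective : ∀ {k} → (V → Fin k) → Set
  Surjective {k} c = ∀ (i : Fin k) → ∃ λ v → c v ≡ i

  -- distinct rainbow codes: for distinct u, v some color class R_i has
  -- d(u, R_i) ≠ d(v, R_i)
  IsLocating : ∀ {k} → (V → Fin k) → Set
  IsLocating {k} c = ∀ u v → u ≢ v → ∃ λ (i : Fin k) → ∀ a b →
    DistTo u (λ x → c x ≡ i) a → DistTo v (λ x → c x ≡ i) b → a ≢ b

  HasRainbowColoring : ℕ → Set
  HasRainbowColoring k = ∃ λ (c : V → Fin k) → IsRainbow c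

  HasLocatingRainbowColoring : ℕ → Set
  HasLocatingRainbowColoring k =
    ∃ λ (c : V → Fin k) → IsRainbow c × Surjective c × IsLocating c

  IsRvc : ℕ → Set
  IsRvc s = 1 ≤ s × HasRainbowColoring s ×
    (∀ k → 1 ≤ k → k < s → ¬ HasRainbowColoring k)

  IsRvcl : ℕ → Set
  IsRvcl r = 1 ≤ r × HasLocatingRainbowColoring r ×
    (∀ k → 1 ≤ k → k < r → ¬ HasLocatingRainbowColoring k)

eqb : ∀ {n} → Fin n → Fin n → Bool
eqb a b = ⌊ a ≟ b ⌋

eqb-sym : ∀ {n} (a b : Fin n) → eqb a b ≡ eqb b a
eqb-sym a b with a ≟ b | b ≟ a
... | yes _ | yes _ = refl
... | no _  | no _  = refl
... | yes p | no q  with q (sym p)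
... | ()
eqb-sym a b | no q | yes p with q (sym p)
... | ()

eqb-refl : ∀ {n} (a : Fin n) → eqb a a ≡ true
eqb-refl a with a ≟ a
... | yes _ = refl
... | no q with q refl
... | ()

K : (n : ℕ) → Graph (Fin n)
K n = record
  { adj = λ a b → not (eqb a b)
  ; adj-sym = λ a b → not-cong (eqb-sym a b)
  ; adj-irr = λ a → notTrue (eqb-refl a)
  }
  where
    not-cong : ∀ {x y} → x ≡ y → not x ≡ not y
    not-cong refl = refl
    notTrue : ∀ {x} → x ≡ true → not x ≡ false
    notTrue refl = refl

-- Edge corona G ⋄ H for G on Fin m. The edges of G are indexed by the
-- type Edge G of pairs (a , b) with a < b and a ~ b; copy e of H is joined
-- to both end vertices of e.

Edge : ∀ {m} → Graph (Fin m) → Set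
Edge {m} G = Σ (Fin m × Fin m) λ p →
  (toℕ (proj₁ p) < toℕ (proj₂ p)) × adj G (proj₁ p) (proj₂ p) ≡ true

sameEdge : ∀ {m} {G : Graph (Fin m)} → Edge G → Edge G → Bool
sameEdge ((a , b) , _) ((a' , b') , _) = eqb a a' ∧ eqb b b'

sameEdge-sym : ∀ {m} {G : Graph (Fin m)} (e f : Edge G) →
  sameEdge {G = G} e f ≡ sameEdge {G = G} f e
sameEdge-sym ((a , b) , _) ((a' , b') , _) =
  cong₂ _∧_ (eqb-sym a a') (eqb-sym b b')

isEnd : ∀ {m} {G : Graph (Fin m)} → Fin m → Edge G → Bool
isEnd x ((a , b) , _) = eqb x a ∨ eqb x b

module _ {m} {W : Set} (G : Graph (Fin m)) (H : Graph W) where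

  private
    A : Fin m ⊎ (Edge G × W) → Fin m ⊎ (Edge G × W) → Bool
    A (inj₁ a) (inj₁ b) = adj G a b
    A (inj₁ a) (inj₂ (e , x)) = isEnd {G = G} a e
    A (inj₂ (e , x)) (inj₁ b) = isEnd {G = G} b e
    A (inj₂ (e , x)) (inj₂ (f , y)) = sameEdge {G = G} e f ∧ adj H x y

    A-sym : ∀ u v → A u v ≡ A v u
    A-sym (inj₁ a) (inj₁ b) = adj-sym G a b
    A-sym (inj₁ a) (inj₂ _) = refl
    A-sym (inj₂ _) (inj₁ b) = refl
    A-sym (inj₂ (e , x)) (inj₂ (f , y)) =
      cong₂ _∧_ (sameEdge-sym {G = G} e f) (adj-sym H x y)

    A-irr : ∀ v → A v v ≡ false
    A-irr (inj₁ a) = adj-irr G a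
    A-irr (inj₂ (e , x)) rewrite adj-irr H x = ∧-comm (sameEdge {G = G} e e) false

  _⋄_ : Graph (Fin m ⊎ (Edge G × W))
  _⋄_ = record { adj = A ; adj-sym = A-sym ; adj-irr = A-irr }

{-# OPTIONS --safe #-}

-- Upper bound: give every base vertex a colour of its own and the vertex x of every
-- copy of K_n the colour m + x. Base paths then have rainbow interiors, and two copy
-- vertices of equal colour lie over different edges e ≠ f, so they are separated by the
-- colour of an end of e that is not an end of f. Hence rvcl ≤ m + n ≤ 2m + n − 2.
--
-- Lower bounds: deleting the copy vertices from a rainbow path between base vertices
-- leaves a rainbow path of T, so rvc(T) ≤ rvcl. If a is a leaf of T with neighbour b,
-- then a and the copy of K_n over ab are n + 1 pairwise adjacent vertices whose only
-- other neighbour is b; as closed twins they need distinct colours. With only n + 1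
-- colours, b shares its colour with one of them, u, and every colour then occurs in
-- N[u] ∩ N[b], so u and b have the same rainbow code.

module Submission where

open import Defs
open import Data.Nat using (ℕ; zero; suc; _≤_; _<_; _+_; _*_; _∸_; _⊔_; z≤n; s≤s; _≤?_)
open import Data.Nat.Properties
  using (≤-refl; ≤-trans; ≤-antisym; ≰⇒>; n≤1+n; 1+n≰n; n≤0⇒n≡0; +-suc; +-comm; m≤m+n; ⊔-lub;
         <-irrelevant; <-irrefl; <-asym; <-cmp)
open import Data.Nat.Tactic.RingSolver using (solve-∀)
open import Data.Fin using (Fin; toℕ; punchOut; _↑ˡ_; _↑ʳ_; splitAt)
  renaming (zero to fzero; suc to fsuc)
open import Data.Fin.Properties
  using (any?; injective⇒≤; toℕ-injective; punchOut-injective; ↑ˡ-injective; ↑ʳ-injective;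
         splitAt-↑ˡ; splitAt-↑ʳ; splitAt⁻¹-↑ˡ; splitAt⁻¹-↑ʳ) renaming (_≟_ to _≟ᶠ_)
open import Data.Bool using (true; false; _∧_)
open import Data.Bool.Properties using (∨-zeroʳ) renaming (_≟_ to _≟ᵇ_)
open import Axiom.UniquenessOfIdentityProofs using (module Decidable⇒UIP)
open import Data.Sum using (_⊎_; inj₁; inj₂)
open import Data.Sum.Properties using (inj₁-injective)
open import Data.Product using (Σ; ∃; ∃₂; _×_; _,_; proj₁; proj₂)
open import Data.List using (List; []; _∷_; _++_; map; length; lookup)
open import Data.List.Properties using (map-++; map-∘; ++-assoc)
open import Function using (_∘_; _on_)
open import Function.Definitions using (Injective)
open import Data.List.Relation.Unary.Linked using (Linked; []; [-]; _∷_)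
import Data.List.Relation.Unary.Linked.Properties as Linked
open import Data.List.Relation.Unary.AllPairs as AllPairs using (AllPairs; []; _∷_)
import Data.List.Relation.Unary.AllPairs.Properties as AllPairs
open import Data.List.Relation.Unary.Unique.Propositional using (Unique)
import Data.List.Relation.Unary.Unique.Propositional.Properties as Unique
open import Data.List.Relation.Unary.All as All using (All; []; _∷_)
open import Data.List.Relation.Unary.All.Properties using (¬Any⇒All¬; ++⁻ˡ)
open import Data.List.Relation.Unary.Any using (here; there)
open import Data.List.Membership.Propositional using (_∈_; _∉_)
open import Data.List.Membership.Propositional.Properties using (∈-++⁻; ∈-∃++; ∈-lookup)
open import Data.Empty using (⊥-elim)
open import Relation.Nullary using (¬_; yes; no; _×-dec_; ¬?)
open import Relation.Binary.Definitions using (DecidableEquality; tri<; tri≈; tri>)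
open import Relation.Binary.PropositionalEquality
  using (_≡_; _≢_; refl; sym; trans; cong; cong₂; subst; subst₂)

module _ {A : Set} {R : A → A → Set} where

  Linked-++⁻ˡ : ∀ xs {ys} → Linked R (xs ++ ys) → Linked R xs
  Linked-++⁻ˡ []           _       = []
  Linked-++⁻ˡ (x ∷ [])     _       = [-]
  Linked-++⁻ˡ (x ∷ y ∷ xs) (r ∷ l) = r ∷ Linked-++⁻ˡ (y ∷ xs) l

  Linked-++⁻ʳ : ∀ xs {ys} → Linked R (xs ++ ys) → Linked R ys
  Linked-++⁻ʳ []           l       = l
  Linked-++⁻ʳ (x ∷ [])     [-]     = []
  Linked-++⁻ʳ (x ∷ [])     (_ ∷ l) = l
  Linked-++⁻ʳ (x ∷ y ∷ xs) (_ ∷ l) = Linked-++⁻ʳ (y ∷ xs) l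

  Linked-∷ʳ : ∀ xs {v w} → Linked R (xs ++ v ∷ []) → R v w →
              Linked R ((xs ++ v ∷ []) ++ w ∷ [])
  Linked-∷ʳ []           _       r = r ∷ [-]
  Linked-∷ʳ (x ∷ [])     (s ∷ _) r = s ∷ r ∷ [-]
  Linked-∷ʳ (x ∷ y ∷ xs) (s ∷ l) r = s ∷ Linked-∷ʳ (y ∷ xs) l r

  AllPairs-++⁻ˡ : ∀ xs {ys} → AllPairs R (xs ++ ys) → AllPairs R xs
  AllPairs-++⁻ˡ []       _        = []
  AllPairs-++⁻ˡ (x ∷ xs) (a ∷ ps) = ++⁻ˡ xs a ∷ AllPairs-++⁻ˡ xs ps

  AllPairs-++⁻ʳ : ∀ xs {ys} → AllPairs R (xs ++ ys) → AllPairs R ys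
  AllPairs-++⁻ʳ []       ps       = ps
  AllPairs-++⁻ʳ (x ∷ xs) (_ ∷ ps) = AllPairs-++⁻ʳ xs ps

Unique-∷ʳ : ∀ {A : Set} {xs : List A} {w} → Unique xs → w ∉ xs → Unique (xs ++ w ∷ [])
Unique-∷ʳ u w∉xs = Unique.++⁺ u ([] ∷ []) λ { (w∈xs , here refl) → w∉xs w∈xs }

lookup-injective : ∀ {A : Set} {xs : List A} → Unique xs →
  ∀ i j → lookup xs i ≡ lookup xs j → i ≡ j
lookup-injective (_  ∷ _)  fzero    fzero    _  = refl
lookup-injective (x∉ ∷ _)  fzero    (fsuc j) eq = ⊥-elim (All.lookup x∉ (∈-lookup j) eq)
lookup-injective (x∉ ∷ _)  (fsuc i) fzero    eq = ⊥-elim (All.lookup x∉ (∈-lookup i) (sym eq))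
lookup-injective (_  ∷ un) (fsuc i) (fsuc j) eq = cong fsuc (lookup-injective un i j eq)

Unique⇒length≤ : ∀ {m} {xs : List (Fin m)} → Unique xs → length xs ≤ m
Unique⇒length≤ un = injective⇒≤ (lookup-injective un _ _)

injective⇒surjective : ∀ {k r} {f : Fin k → Fin r} → Injective _≡_ _≡_ f → r ≤ k →
  ∀ i → ∃ λ t → f t ≡ i
injective⇒surjective {f = f} inj r≤k i with any? (λ t → f t ≟ᶠ i)
... | yes hit = hit
injective⇒surjective {k} {suc r} {f} inj r≤k i | no miss =
  ⊥-elim (<-irrefl refl (≤-trans r≤k (injective⇒≤ f′-injective)))
  where
  i≢f : ∀ t → i ≢ f t
  i≢f t i≡ft = miss (t , sym i≡ft)
  f′ : Fin k → Fin r
  f′ t = punchOut (i≢f t)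
  f′-injective : Injective _≡_ _≡_ f′
  f′-injective = inj ∘ punchOut-injective (i≢f _) (i≢f _)

¬¬-least : (Q : ℕ → Set) {k : ℕ} → Q k → ¬ ¬ ∃ λ j → Q j × (∀ i → Q i → j ≤ i)
¬¬-least Q {k} qk noLeast = below (suc k) k ≤-refl qk
  where
  below : ∀ b j → j < b → ¬ Q j
  below (suc b) j (s≤s j≤b) qj = noLeast (j , qj , least)
    where
    least : ∀ i → Q i → j ≤ i
    least i qi with j ≤? i
    ... | yes j≤i = j≤i
    ... | no j≰i  = ⊥-elim (below b i (≤-trans (≰⇒> j≰i) j≤b) qi)

module _ {V : Set} (G : Graph V) where

  IsPath : V → List V → V → Set
  IsPath u is v = Linked (Adj G) (u ∷ is ++ v ∷ []) × Unique (u ∷ is ++ v ∷ [])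

  Adj⇒≢ : ∀ {u v} → Adj G u v → u ≢ v
  Adj⇒≢ {u} r refl with trans (sym r) (adj-irr G u)
  ... | ()

  Adj-sym : ∀ {u v} → Adj G u v → Adj G v u
  Adj-sym {u} {v} r = trans (adj-sym G v u) r

  edge-path : ∀ {u v} → Adj G u v → IsPath u [] v
  edge-path r = r ∷ [-] , (Adj⇒≢ r ∷ []) ∷ [] ∷ []

  path-∷ : ∀ {w u is v} → Adj G w u → w ∉ u ∷ is ++ v ∷ [] → IsPath u is v →
           IsPath w (u ∷ is) v
  path-∷ r w∉ (l , un) = r ∷ l , ¬Any⇒All¬ _ w∉ ∷ un

  path-∷ʳ : ∀ {u is v w} → IsPath u is v → Adj G v w → w ∉ u ∷ is ++ v ∷ [] →
            IsPath u (is ++ v ∷ []) w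
  path-∷ʳ {u} {is} (l , un) r w∉ = Linked-∷ʳ (u ∷ is) l r , Unique-∷ʳ un w∉

  path-init-unique : ∀ {u is v} → IsPath u is v → Unique (u ∷ is)
  path-init-unique {u} {is} (_ , un) = AllPairs-++⁻ˡ (u ∷ is) un

  path-tail-unique : ∀ {u is v} → IsPath u is v → Unique (is ++ v ∷ [])
  path-tail-unique (_ , _ ∷ un) = un

  path-inner-unique : ∀ {u is v} → IsPath u is v → Unique is
  path-inner-unique {is = is} p = AllPairs-++⁻ˡ is (path-tail-unique p)

  path-suffix : ∀ pre {u post v} →
    Linked (Adj G) (pre ++ u ∷ post ++ v ∷ []) → Unique (pre ++ u ∷ post ++ v ∷ []) →
    IsPath u post v
  path-suffix pre l un = Linked-++⁻ʳ pre l , AllPairs-++⁻ʳ pre un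

  module _ (_≟_ : DecidableEquality V) where
    open import Data.List.Membership.DecPropositional _≟_ using (_∈?_)

    path-∷-or-shortcut : ∀ {u w is v} → Adj G u w → u ≢ v → IsPath w is v →
                         ∃ λ js → IsPath u js v
    path-∷-or-shortcut {u} {w} {is} {v} r u≢v p@(l , un) with u ∈? w ∷ is
    ... | no u∉ = w ∷ is , path-∷ r u∉path p
      where
      u∉path : u ∉ w ∷ is ++ v ∷ []
      u∉path u∈ with ∈-++⁻ (w ∷ is) u∈
      ... | inj₁ u∈w∷is    = u∉ u∈w∷is
      ... | inj₂ (here u≡v) = u≢v u≡v
    ... | yes u∈ with ∈-∃++ u∈
    ...   | pre , post , w∷is≡ = post , path-suffix pre (subst (Linked (Adj G)) split l)
                                                      (subst Unique split un)
      where
      split : w ∷ is ++ v ∷ [] ≡ pre ++ u ∷ post ++ v ∷ []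
      split = trans (cong (_++ v ∷ []) w∷is≡) (++-assoc pre (u ∷ post) (v ∷ []))

    walk⇒path : ∀ {u v k} → Walk G u v k → u ≡ v ⊎ ∃ λ is → IsPath u is v
    walk⇒path here = inj₁ refl
    walk⇒path {u} {v} (step r wk) with u ≟ v | walk⇒path wk
    ... | yes u≡v | _                = inj₁ u≡v
    ... | no _    | inj₁ refl        = inj₂ ([] , edge-path r)
    ... | no u≢v  | inj₂ (is , path) = inj₂ (path-∷-or-shortcut r u≢v path)

    connected⇒path : Connected G → ∀ {u v} → u ≢ v → ∃ λ is → IsPath u is v
    connected⇒path conn {u} {v} u≢v with walk⇒path (proj₂ (conn u v))
    ... | inj₁ u≡v = ⊥-elim (u≢v u≡v)
    ... | inj₂ path = path

  linked⇒walk : ∀ {u v} is → Linked (Adj G) (u ∷ is ++ v ∷ []) → ∃ (Walk G u v)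
  linked⇒walk []       (r ∷ [-]) = 1 , step r here
  linked⇒walk (w ∷ is) (r ∷ l)   = let k , wk = linked⇒walk is l in suc k , step r wk

  rainbow⇒¬¬walk : ∀ {k} {c : V → Fin k} → IsRainbow G c → ∀ u v → ¬ ¬ ∃ (Walk G u v)
  rainbow⇒¬¬walk rb u v noWalk = noWalk (linked⇒walk _ (proj₁ (proj₂ (rb u v u≢v))))
    where
    u≢v : u ≢ v
    u≢v refl = noWalk (0 , here)

  DistTo-zero : ∀ {v} {P : V → Set} → P v → DistTo G v P 0
  DistTo-zero pv = (_ , pv , here) , λ _ _ _ _ → z≤n

  DistTo-zero⁻ : ∀ {v} {P : V → Set} → DistTo G v P 0 → P v
  DistTo-zero⁻ ((_ , px , here) , _) = px

  DistTo-one : ∀ {v x} {P : V → Set} → ¬ P v → P x → Adj G v x → DistTo G v P 1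
  DistTo-one {P = P} ¬pv px r = (_ , px , step r here) , least
    where
    least : ∀ y j → P y → Walk G _ y j → 1 ≤ j
    least _ zero    py here = ⊥-elim (¬pv py)
    least _ (suc j) _  _    = s≤s z≤n

  DistTo-one⁻ : ∀ {v} {P : V → Set} → DistTo G v P 1 → ∃ λ x → P x × Adj G v x
  DistTo-one⁻ ((x , px , step r here) , _) = x , px , r

  ¬¬DistTo : ∀ {v x} {P : V → Set} → ¬ ¬ ∃ (Walk G v x) → P x → ¬ ¬ ∃ (DistTo G v P)
  ¬¬DistTo {v} {x} {P} ¬¬walk px noDist = ¬¬walk λ (j , wk) →
    ¬¬-least (λ j → ∃ λ y → P y × Walk G v y j) (x , px , wk)
      λ (α , reach , least) → noDist (α , reach , λ y j py wk → least j (y , py , wk))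

  -- N(u) ⊆ N[v]; for adjacent u and v this says N[u] ⊆ N[v].
  Dominates : V → V → Set
  Dominates v u = ∀ w → Adj G u w → w ≡ v ⊎ Adj G v w

  walk-from-dominator : ∀ {u v} {P : V → Set} → Dominates v u → (P u → P v) →
    ∀ {x α} → P x → Walk G u x α → ∃₂ λ y j → P y × Walk G v y j × j ≤ α
  walk-from-dominator dom pu⇒pv px here = _ , 0 , pu⇒pv px , here , z≤n
  walk-from-dominator dom pu⇒pv {α = suc α} px (step {w = w} r wk) with dom w r
  ... | inj₁ refl = _ , α , px , wk , n≤1+n α
  ... | inj₂ r′   = _ , suc α , px , step r′ wk , ≤-refl

  DistTo-dominated : ∀ {u v α β} {P : V → Set} → Dominates v u → (P u → P v) →
    DistTo G u P α → DistTo G v P β → β ≤ α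
  DistTo-dominated dom pu⇒pv ((_ , px , wk) , _) (_ , least)
    with walk-from-dominator dom pu⇒pv px wk
  ... | y , j , py , wk′ , j≤α = ≤-trans (least y j py wk′) j≤α

  Separates : ∀ {k} → (V → Fin k) → Fin k → V → V → Set
  Separates c i u v =
    ∀ a b → DistTo G u (λ x → c x ≡ i) a → DistTo G v (λ x → c x ≡ i) b → a ≢ b

  module _ {k} {c : V → Fin k} where

    own-colour-separates : ∀ {u v} → c u ≢ c v → Separates c (c u) u v
    own-colour-separates cu≢cv a b du@(_ , least) dv a≡b =
      cu≢cv (sym (DistTo-zero⁻ (subst (DistTo G _ _) b≡0 dv)))
      where
      b≡0 : b ≡ 0
      b≡0 = trans (sym a≡b) (n≤0⇒n≡0 (least _ 0 refl here))

    lone-neighbour-separates : ∀ {i z u v} → (∀ x → c x ≡ i → x ≡ z) → c z ≡ i →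
      Adj G u z → ¬ Adj G v z → Separates c i u v
    lone-neighbour-separates lone cz r ¬r′ zero _ du _ _ = Adj⇒≢ r (lone _ (DistTo-zero⁻ du))
    lone-neighbour-separates lone cz r ¬r′ (suc zero) _ _ dv refl with DistTo-one⁻ dv
    ... | x , cx , r′ with lone x cx
    ...   | refl = ¬r′ r′
    lone-neighbour-separates lone cz r ¬r′ (suc (suc a)) _ (_ , least) _ _
      with least _ 1 cz (step r here)
    ... | s≤s ()

    unseparated : ∀ {u v} → c u ≡ c v →
      (∀ i → ∃ λ x → c x ≡ i × (x ≡ u ⊎ Adj G u x) × (x ≡ v ⊎ Adj G v x)) →
      ∀ i → ¬ Separates c i u v
    unseparated {u} {v} cu≡cv near i separates with c u ≟ᶠ i | near i
    ... | yes cu≡i | _ =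
      separates 0 0 (DistTo-zero cu≡i) (DistTo-zero (trans (sym cu≡cv) cu≡i)) refl
    ... | no cu≢i | x , cx , x~u , x~v =
      separates 1 1 (DistTo-one cu≢i cx (proper x~u cu≢i))
                    (DistTo-one cv≢i cx (proper x~v cv≢i)) refl
      where
      cv≢i : c v ≢ i
      cv≢i cv≡i = cu≢i (trans cu≡cv cv≡i)
      proper : ∀ {w} → x ≡ w ⊎ Adj G w x → c w ≢ i → Adj G w x
      proper (inj₁ refl) cw≢i = ⊥-elim (cw≢i cx)
      proper (inj₂ r)    _    = r

    twins-coloured-apart : IsRainbow G c → Surjective G c → IsLocating G c →
      ∀ {u v} → u ≢ v → Dominates v u → Dominates u v → c u ≢ c v
    twins-coloured-apart rb sj loc {u} {v} u≢v v≽u u≽v cu≡cv with loc u v u≢v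
    ... | i , separates with sj i
    ...   | x , cx =
      ¬¬DistTo (rainbow⇒¬¬walk rb u x) cx λ (α , du) →
      ¬¬DistTo (rainbow⇒¬¬walk rb v x) cx λ (β , dv) →
      separates α β du dv (≤-antisym (DistTo-dominated u≽v (trans cu≡cv) dv du)
                                     (DistTo-dominated v≽u (trans (sym cu≡cv)) du dv))

module _ {m : ℕ} (T : Graph (Fin m)) where
  open import Data.List.Membership.DecPropositional (_≟ᶠ_ {m}) using (_∈?_)

  adjacent-pair : 2 ≤ m → Connected T → ∃₂ (Adj T)
  adjacent-pair (s≤s (s≤s _)) conn with conn fzero (fsuc fzero)
  ... | _ , step r _ = _ , _ , r

  acyclic⇒no-chord : Acyclic T → ∀ {p q w rest} → w ∈ rest →
    Linked (Adj T) (p ∷ q ∷ rest) → Unique (p ∷ q ∷ rest) → ¬ Adj T p w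
  acyclic⇒no-chord acyclic {p} {q} {w} w∈rest l un r with ∈-∃++ w∈rest
  ... | pre , post , refl = acyclic p (q ∷ pre ++ w ∷ []) (length≥2 pre , unique , linked)
    where
    length≥2 : ∀ pre → 2 ≤ length (q ∷ pre ++ w ∷ [])
    length≥2 []      = s≤s (s≤s z≤n)
    length≥2 (_ ∷ _) = s≤s (s≤s z≤n)
    reassoc : p ∷ q ∷ pre ++ w ∷ post ≡ (p ∷ q ∷ pre ++ w ∷ []) ++ post
    reassoc = cong (λ xs → p ∷ q ∷ xs) (sym (++-assoc pre (w ∷ []) post))
    unique : Unique (p ∷ q ∷ pre ++ w ∷ [])
    unique = AllPairs-++⁻ˡ (p ∷ q ∷ pre ++ w ∷ []) (subst Unique reassoc un)
    linked : Linked (Adj T) (p ∷ (q ∷ pre ++ w ∷ []) ++ p ∷ [])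
    linked = Linked-∷ʳ (p ∷ q ∷ pre)
               (Linked-++⁻ˡ (p ∷ q ∷ pre ++ w ∷ []) (subst (Linked (Adj T)) reassoc l))
               (Adj-sym T r)

  IsLeaf : Fin m → Fin m → Set
  IsLeaf a b = Adj T a b × (∀ w → Adj T a w → w ≡ b)

  module _ (tree : IsTree T) where

    -- Extend the path at its head p while p has a neighbour off the path (at most m
    -- times, as paths have at most m vertices); once stuck, acyclicity makes p a leaf.
    grow-to-leaf : ∀ fuel p q rest → m ≤ fuel + length rest →
      Linked (Adj T) (p ∷ q ∷ rest) → Unique (p ∷ q ∷ rest) → ∃₂ IsLeaf
    grow-to-leaf zero p q rest m≤ l un =
      ⊥-elim (1+n≰n (≤-trans (n≤1+n _) (≤-trans (Unique⇒length≤ un) m≤)))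
    grow-to-leaf (suc fuel) p q rest m≤ l@(r ∷ _) un
      with any? (λ w → (adj T p w ≟ᵇ true) ×-dec ¬? (w ∈? p ∷ q ∷ rest))
    ... | yes (w , r′ , w∉) =
      grow-to-leaf fuel w p (q ∷ rest) (subst (m ≤_) (sym (+-suc fuel (length rest))) m≤)
        (Adj-sym T r′ ∷ l) (¬Any⇒All¬ _ w∉ ∷ un)
    ... | no stuck = p , q , r , only-q
      where
      only-q : ∀ w → Adj T p w → w ≡ q
      only-q w r′ with w ∈? p ∷ q ∷ rest
      ... | no w∉                      = ⊥-elim (stuck (w , r′ , w∉))
      ... | yes (here w≡p)             = ⊥-elim (Adj⇒≢ T r′ (sym w≡p))
      ... | yes (there (here w≡q))     = w≡q
      ... | yes (there (there w∈rest)) = ⊥-elim (acyclic⇒no-chord (proj₂ tree) w∈rest l un r′)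

    leaf-exists : 2 ≤ m → ∃₂ IsLeaf
    leaf-exists 2≤m with adjacent-pair 2≤m (proj₁ tree)
    ... | a , b , r =
      let l , un = edge-path T (Adj-sym T r) in grow-to-leaf m b a [] (m≤m+n m 0) l un

∧-true⁻ : ∀ {x y} → x ∧ y ≡ true → x ≡ true × y ≡ true
∧-true⁻ {true} {true} _ = refl , refl

eqb⇒≡ : ∀ {n} {a b : Fin n} → eqb a b ≡ true → a ≡ b
eqb⇒≡ {a = a} {b} eq with a ≟ᶠ b
... | yes a≡b = a≡b

≢⇒eqb : ∀ {n} {a b : Fin n} → a ≢ b → eqb a b ≡ false
≢⇒eqb {a = a} {b} a≢b with a ≟ᶠ b
... | yes a≡b = ⊥-elim (a≢b a≡b)
... | no _    = refl

module Edges {m : ℕ} (G : Graph (Fin m)) where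

  low high : Edge G → Fin m
  low  ((a , _) , _) = a
  high ((_ , b) , _) = b

  low<high : (e : Edge G) → toℕ (low e) < toℕ (high e)
  low<high (_ , lt , _) = lt

  low≢high : (e : Edge G) → low e ≢ high e
  low≢high e eq = <-irrefl (cong toℕ eq) (low<high e)

  _∈ₑ_ : Fin m → Edge G → Set
  t ∈ₑ e = isEnd {G = G} t e ≡ true

  low∈ₑ : (e : Edge G) → low e ∈ₑ e
  low∈ₑ ((a , _) , _) rewrite eqb-refl a = refl

  high∈ₑ : (e : Edge G) → high e ∈ₑ e
  high∈ₑ ((a , b) , _) rewrite eqb-refl b = ∨-zeroʳ (eqb b a)

  ∈ₑ⁻ : ∀ {t} (e : Edge G) → t ∈ₑ e → t ≡ low e ⊎ t ≡ high e
  ∈ₑ⁻ {t} ((a , b) , _) t∈e with t ≟ᶠ a | t ≟ᶠ b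
  ... | yes t≡a | _       = inj₁ t≡a
  ... | no _    | yes t≡b = inj₂ t≡b

  ends-adjacent : ∀ {p q} (e : Edge G) → p ∈ₑ e → q ∈ₑ e → p ≢ q → Adj G p q
  ends-adjacent {p} {q} e p∈e q∈e p≢q with ∈ₑ⁻ {p} e p∈e | ∈ₑ⁻ {q} e q∈e
  ... | inj₁ refl | inj₁ refl = ⊥-elim (p≢q refl)
  ... | inj₁ refl | inj₂ refl = proj₂ (proj₂ e)
  ... | inj₂ refl | inj₁ refl = Adj-sym G (proj₂ (proj₂ e))
  ... | inj₂ refl | inj₂ refl = ⊥-elim (p≢q refl)

  edge-through : ∀ {a b} → Adj G a b → Σ (Edge G) λ e → a ∈ₑ e × b ∈ₑ e
  edge-through {a} {b} r with <-cmp (toℕ a) (toℕ b)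
  ... | tri< a<b _ _ = let e = (a , b) , a<b , r in e , low∈ₑ e , high∈ₑ e
  ... | tri≈ _ a≡b _ = ⊥-elim (Adj⇒≢ G r (toℕ-injective a≡b))
  ... | tri> _ _ b<a = let e = (b , a) , b<a , Adj-sym G r in e , high∈ₑ e , low∈ₑ e

  Edge-≡ : (e f : Edge G) → low e ≡ low f → high e ≡ high f → e ≡ f
  Edge-≡ (_ , lt , r) (_ , lt′ , r′) refl refl =
    cong₂ (λ lt r → _ , lt , r) (<-irrelevant lt lt′) (Decidable⇒UIP.≡-irrelevant _≟ᵇ_ r r′)

  edge-ext : ∀ {e f : Edge G} → (∀ t → t ∈ₑ e → t ∈ₑ f) → e ≡ f
  edge-ext {e} {f} e⊆f
    with ∈ₑ⁻ {low e} f (e⊆f (low e) (low∈ₑ e)) | ∈ₑ⁻ {high e} f (e⊆f (high e) (high∈ₑ e))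
  ... | inj₁ l≡l | inj₂ h≡h = Edge-≡ e f l≡l h≡h
  ... | inj₁ l≡l | inj₁ h≡l = ⊥-elim (low≢high e (trans l≡l (sym h≡l)))
  ... | inj₂ l≡h | inj₂ h≡h = ⊥-elim (low≢high e (trans l≡h (sym h≡h)))
  ... | inj₂ l≡h | inj₁ h≡l =
    ⊥-elim (<-asym (low<high e)
                   (subst₂ _<_ (cong toℕ (sym h≡l)) (cong toℕ (sym l≡h)) (low<high f)))

  unshared-end : ∀ {e f : Edge G} → e ≢ f → ∃ λ t → t ∈ₑ e × ¬ t ∈ₑ f
  unshared-end {e} {f} e≢f
    with isEnd {G = G} (low e) f ≟ᵇ true | isEnd {G = G} (high e) f ≟ᵇ true
  ... | no low∉f  | _          = low e , low∈ₑ e , low∉f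
  ... | yes _     | no high∉f  = high e , high∈ₑ e , high∉f
  ... | yes low∈f | yes high∈f = ⊥-elim (e≢f (edge-ext λ t t∈e → end∈f (∈ₑ⁻ {t} e t∈e)))
    where
    end∈f : ∀ {t} → t ≡ low e ⊎ t ≡ high e → t ∈ₑ f
    end∈f (inj₁ refl) = low∈f
    end∈f (inj₂ refl) = high∈f

  sameEdge⇒≡ : ∀ {e f : Edge G} → sameEdge {G = G} e f ≡ true → e ≡ f
  sameEdge⇒≡ {e} {f} same =
    let l , h = ∧-true⁻ {eqb (low e) (low f)} same in Edge-≡ e f (eqb⇒≡ l) (eqb⇒≡ h)

  sameEdge-refl : (e : Edge G) → sameEdge {G = G} e e ≡ true
  sameEdge-refl ((a , b) , _) rewrite eqb-refl a | eqb-refl b = refl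

module Corona {m : ℕ} {W : Set} (T : Graph (Fin m)) (H : Graph W) where
  open Edges T

  Vertex : Set
  Vertex = Fin m ⊎ (Edge T × W)

  copy-adjacent⇒same-edge : ∀ {e f x y} → Adj (T ⋄ H) (inj₂ (e , x)) (inj₂ (f , y)) → e ≡ f
  copy-adjacent⇒same-edge {e} {f} r = sameEdge⇒≡ (proj₁ (∧-true⁻ {sameEdge {G = T} e f} r))

  basePart : List Vertex → List (Fin m)
  basePart []            = []
  basePart (inj₁ a ∷ xs) = a ∷ basePart xs
  basePart (inj₂ _ ∷ xs) = basePart xs

  basePart-++ : ∀ xs ys → basePart (xs ++ ys) ≡ basePart xs ++ basePart ys
  basePart-++ []            ys = refl
  basePart-++ (inj₁ a ∷ xs) ys = cong (a ∷_) (basePart-++ xs ys)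
  basePart-++ (inj₂ _ ∷ xs) ys = basePart-++ xs ys

  basePart-All : ∀ {P : Vertex → Set} {xs} → All P xs → All (P ∘ inj₁) (basePart xs)
  basePart-All {xs = []}          []         = []
  basePart-All {xs = inj₁ _ ∷ _} (px ∷ pxs) = px ∷ basePart-All pxs
  basePart-All {xs = inj₂ _ ∷ _} (_  ∷ pxs) = basePart-All pxs

  basePart-AllPairs : ∀ {R : Vertex → Vertex → Set} {xs} →
    AllPairs R xs → AllPairs (R on inj₁) (basePart xs)
  basePart-AllPairs {xs = []}          []         = []
  basePart-AllPairs {xs = inj₁ _ ∷ _} (px ∷ pxs) = basePart-All px ∷ basePart-AllPairs pxs
  basePart-AllPairs {xs = inj₂ _ ∷ _} (_  ∷ pxs) = basePart-AllPairs pxs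

  Over : Vertex → Fin m → Set
  Over (inj₁ q)       p = q ≡ p
  Over (inj₂ (e , _)) p = p ∈ₑ e

  over-adjacent-base : ∀ {w p q} → Over w p → Adj (T ⋄ H) w (inj₁ q) → p ≢ q → Adj T p q
  over-adjacent-base {inj₁ _}       refl r _   = r
  over-adjacent-base {inj₂ (e , _)} p∈e  r p≢q = ends-adjacent e p∈e r p≢q

  over-adjacent-copy : ∀ {w p f z} → Over w p → Adj (T ⋄ H) w (inj₂ (f , z)) → p ∈ₑ f
  over-adjacent-copy {inj₁ _}       refl r = r
  over-adjacent-copy {inj₂ (e , _)} {f = f} p∈e r with copy-adjacent⇒same-edge {e} {f} r
  ... | refl = p∈e

  -- A run of copy vertices on a path lies in one copy and is flanked by two ends of its edge.
  basePart-linked : ∀ {w p} ys → Over w p → All (inj₁ p ≢_) ys → Unique ys →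
    Linked (Adj (T ⋄ H)) (w ∷ ys) → Linked (Adj T) (p ∷ basePart ys)
  basePart-linked []                  _   _             _           _       = [-]
  basePart-linked (inj₁ q ∷ ys)       w/p (p≢q ∷ _)     (q∉ys ∷ un) (r ∷ l) =
    over-adjacent-base w/p r (p≢q ∘ cong inj₁) ∷ basePart-linked ys refl q∉ys un l
  basePart-linked (inj₂ (f , z) ∷ ys) w/p (_ ∷ p∉ys)    (_ ∷ un)    (r ∷ l) =
    basePart-linked ys (over-adjacent-copy w/p r) p∉ys un l

  restriction-rainbow : ∀ {k} {c : Vertex → Fin k} →
    IsRainbow (T ⋄ H) c → IsRainbow T (c ∘ inj₁)
  restriction-rainbow {c = c} rb a b a≢b with rb (inj₁ a) (inj₁ b) (a≢b ∘ inj₁-injective)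
  ... | is , l , un@(a∉ ∷ un′) , colours =
    basePart is ,
    subst (λ xs → Linked (Adj T) (a ∷ xs)) (basePart-++ is (inj₁ b ∷ []))
      (basePart-linked (is ++ inj₁ b ∷ []) refl a∉ un′ l) ,
    subst (λ xs → Unique (a ∷ xs)) (basePart-++ is (inj₁ b ∷ []))
      (AllPairs.map (_∘ cong inj₁) (basePart-AllPairs un)) ,
    AllPairs.map⁺ (basePart-AllPairs (AllPairs.map⁻ colours))

module LeafClique {m n : ℕ} (T : Graph (Fin m)) {a b : Fin m} (leaf : IsLeaf T a b) where
  open Edges T
  open Corona T (K n)

  private
    C : Graph Vertex
    C = T ⋄ K n

  e : Edge T
  e = proj₁ (edge-through (proj₁ leaf))

  a∈e : a ∈ₑ e
  a∈e = proj₁ (proj₂ (edge-through (proj₁ leaf)))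

  b∈e : b ∈ₑ e
  b∈e = proj₂ (proj₂ (edge-through (proj₁ leaf)))

  ends-at-leaf : ∀ {f t} → a ∈ₑ f → t ∈ₑ f → t ≡ a ⊎ t ≡ b
  ends-at-leaf {f} {t} a∈f t∈f with t ≟ᶠ a
  ... | yes t≡a = inj₁ t≡a
  ... | no t≢a  = inj₂ (proj₂ leaf t (ends-adjacent f a∈f t∈f (t≢a ∘ sym)))

  edge-at-leaf : ∀ {f} → a ∈ₑ f → f ≡ e
  edge-at-leaf {f} a∈f = edge-ext λ t t∈f → leaf-end∈e (ends-at-leaf {f} {t} a∈f t∈f)
    where
    leaf-end∈e : ∀ {t} → t ≡ a ⊎ t ≡ b → t ∈ₑ e
    leaf-end∈e (inj₁ refl) = a∈e
    leaf-end∈e (inj₂ refl) = b∈e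

  member : Fin (suc n) → Vertex
  member fzero    = inj₁ a
  member (fsuc x) = inj₂ (e , x)

  member-injective : Injective _≡_ _≡_ member
  member-injective {fzero}  {fzero}  _    = refl
  member-injective {fsuc _} {fsuc _} refl = refl

  member≢b : ∀ j → member j ≢ inj₁ b
  member≢b fzero    a≡b = Adj⇒≢ T (proj₁ leaf) (inj₁-injective a≡b)
  member≢b (fsuc _) ()

  member-adjacent-b : ∀ j → Adj C (member j) (inj₁ b)
  member-adjacent-b fzero    = proj₁ leaf
  member-adjacent-b (fsuc _) = b∈e

  b-adjacent-member : ∀ j → Adj C (inj₁ b) (member j)
  b-adjacent-member j = Adj-sym C {member j} {inj₁ b} (member-adjacent-b j)

  members-adjacent : ∀ j t → j ≢ t → Adj C (member j) (member t)
  members-adjacent fzero    fzero    j≢t = ⊥-elim (j≢t refl)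
  members-adjacent fzero    (fsuc _) _   = a∈e
  members-adjacent (fsuc _) fzero    _   = a∈e
  members-adjacent (fsuc x) (fsuc y) j≢t
    rewrite sameEdge-refl e | ≢⇒eqb {a = x} {y} (j≢t ∘ cong fsuc) = refl

  member-neighbours : ∀ j w → Adj C (member j) w → w ≡ inj₁ b ⊎ ∃ λ t → w ≡ member t
  member-neighbours fzero    (inj₁ q)       r = inj₁ (cong inj₁ (proj₂ leaf q r))
  member-neighbours fzero    (inj₂ (f , y)) r with edge-at-leaf {f} r
  ... | refl = inj₂ (fsuc y , refl)
  member-neighbours (fsuc x) (inj₁ q)       r with ends-at-leaf {e} {q} a∈e r
  ... | inj₁ refl = inj₂ (fzero , refl)
  ... | inj₂ refl = inj₁ refl
  member-neighbours (fsuc x) (inj₂ (f , y)) r with copy-adjacent⇒same-edge {e} {f} r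
  ... | refl = inj₂ (fsuc y , refl)

  members-dominate : ∀ j t → Dominates C (member t) (member j)
  members-dominate j t w r with member-neighbours j w r
  ... | inj₁ refl = inj₂ (member-adjacent-b t)
  ... | inj₂ (t′ , refl) with t′ ≟ᶠ t
  ...   | yes refl = inj₁ refl
  ...   | no t′≢t  = inj₂ (members-adjacent t t′ (t′≢t ∘ sym))

  no-locating-colouring-below : ∀ {k} (c : Vertex → Fin k) → k ≤ suc n →
    IsRainbow C c → Surjective C c → ¬ IsLocating C c
  no-locating-colouring-below c k≤ rb sj loc =
    let i , separates = loc (member j) (inj₁ b) (member≢b j)
    in unseparated C cj near i separates
    where
    colour-injective : Injective _≡_ _≡_ (c ∘ member)
    colour-injective {j} {t} cj≡ct with j ≟ᶠ t
    ... | yes j≡t = j≡t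
    ... | no j≢t  = ⊥-elim (twins-coloured-apart C rb sj loc (j≢t ∘ member-injective)
                             (members-dominate j t) (members-dominate t j) cj≡ct)
    colour-surjective : ∀ i → ∃ λ t → c (member t) ≡ i
    colour-surjective = injective⇒surjective colour-injective k≤
    j : Fin (suc n)
    j = proj₁ (colour-surjective (c (inj₁ b)))
    cj : c (member j) ≡ c (inj₁ b)
    cj = proj₂ (colour-surjective (c (inj₁ b)))
    near : ∀ i → ∃ λ x → c x ≡ i × (x ≡ member j ⊎ Adj C (member j) x) ×
                                   (x ≡ inj₁ b ⊎ Adj C (inj₁ b) x)
    near i with colour-surjective i
    ... | t , ct with t ≟ᶠ j
    ...   | yes refl = member t , ct , inj₁ refl , inj₂ (b-adjacent-member t)
    ...   | no t≢j   =
      member t , ct , inj₂ (members-adjacent j t (t≢j ∘ sym)) , inj₂ (b-adjacent-member t)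

module BaseCopyColouring {m n : ℕ} (T : Graph (Fin m)) (H : Graph (Fin n)) where
  open Edges T
  open Corona T H

  private
    C : Graph Vertex
    C = T ⋄ H

  colour : Vertex → Fin (m + n)
  colour (inj₁ a)       = a ↑ˡ n
  colour (inj₂ (_ , x)) = m ↑ʳ x

  base≢copy : ∀ {a : Fin m} {x : Fin n} → a ↑ˡ n ≢ m ↑ʳ x
  base≢copy {a} {x} eq
    with trans (sym (splitAt-↑ˡ m a n)) (trans (cong (splitAt m) eq) (splitAt-↑ʳ m n x))
  ... | ()

  base-rainbow : ∀ {js} → Unique js → Unique (map colour (map inj₁ js))
  base-rainbow {js} un = subst Unique (map-∘ js) (Unique.map⁺ (↑ˡ-injective n _ _) un)

  copy∉base++ : ∀ {z : Edge T × Fin n} js {ys : List Vertex} →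
    inj₂ z ∉ ys → inj₂ z ∉ map inj₁ js ++ ys
  copy∉base++ []       z∉ys z∈         = z∉ys z∈
  copy∉base++ (_ ∷ js) z∉ys (here ())
  copy∉base++ (_ ∷ js) z∉ys (there z∈) = copy∉base++ js z∉ys z∈

  lift-path : ∀ {a js b} → IsPath T a js b → IsPath C (inj₁ a) (map inj₁ js) (inj₁ b)
  lift-path {a} {js} {b} (l , un) =
    subst (Linked (Adj C)) lift-++ (Linked.map⁺ l) ,
    subst Unique lift-++ (Unique.map⁺ inj₁-injective un)
    where
    lift-++ : map inj₁ (a ∷ js ++ b ∷ []) ≡ inj₁ a ∷ map inj₁ js ++ inj₁ b ∷ []
    lift-++ = cong (inj₁ a ∷_) (map-++ inj₁ js (b ∷ []))

  lift-path-∷ʳ : ∀ {a js t f y} → IsPath T a js t → t ∈ₑ f →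
    IsPath C (inj₁ a) (map inj₁ (js ++ t ∷ [])) (inj₂ (f , y))
  lift-path-∷ʳ {a} {js} {t} p t∈f =
    subst (λ is → IsPath C (inj₁ a) is _) (sym (map-++ inj₁ js (t ∷ [])))
      (path-∷ʳ C (lift-path p) t∈f (copy∉base++ (a ∷ js) λ { (here ()) }))

  RainbowPath : Vertex → Vertex → Set
  RainbowPath u v = ∃ λ is → Linked (Adj C) (u ∷ is ++ v ∷ []) × Unique (u ∷ is ++ v ∷ []) ×
                             Unique (map colour is)

  via-base : ∀ {u v} js → IsPath C u (map inj₁ js) v → Unique js → RainbowPath u v
  via-base js (l , un) js! = map inj₁ js , l , un , base-rainbow js!

  direct : ∀ {u v} → Adj C u v → RainbowPath u v
  direct r = via-base [] (edge-path C r) []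

  colour-rainbow : Connected T → IsRainbow C colour
  colour-rainbow conn = rainbow
    where
    route : ∀ {s t} → s ≢ t → ∃ λ js → IsPath T s js t
    route = connected⇒path T _≟ᶠ_ conn

    rainbow : IsRainbow C colour
    rainbow (inj₁ a) (inj₁ b) u≢v =
      let js , p = route (u≢v ∘ cong inj₁) in via-base js (lift-path p) (path-inner-unique T p)
    rainbow (inj₁ a) (inj₂ (f , y)) _ with a ≟ᶠ low f
    ... | yes refl = direct (low∈ₑ f)
    ... | no a≢lf  = let js , p = route a≢lf in
      via-base (js ++ low f ∷ []) (lift-path-∷ʳ p (low∈ₑ f)) (path-tail-unique T p)
    rainbow (inj₂ (f , y)) (inj₁ a) _ with low f ≟ᶠ a
    ... | yes refl = direct (low∈ₑ f)
    ... | no lf≢a  = let js , p = route lf≢a in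
      via-base (low f ∷ js)
        (path-∷ C (low∈ₑ f) (copy∉base++ (low f ∷ js) λ { (here ()) }) (lift-path p))
        (path-init-unique T p)
    rainbow u@(inj₂ (e , x)) v@(inj₂ (f , y)) u≢v with adj C u v ≟ᵇ true
    ... | yes r = direct r
    ... | no _ with low e ≟ᶠ low f
    ...   | yes le≡lf = via-base (low e ∷ [])
      (path-∷ C {u} {inj₁ (low e)} {[]} {v} (low∈ₑ e)
        (copy∉base++ (low e ∷ []) λ { (here u≡v) → u≢v u≡v })
        (edge-path C {inj₁ (low e)} {v} (subst (_∈ₑ f) (sym le≡lf) (low∈ₑ f))))
      ([] ∷ [])
    ...   | no le≢lf = let js , p = route le≢lf in
      via-base (low e ∷ js ++ low f ∷ [])
        (path-∷ C (low∈ₑ e)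
          (copy∉base++ (low e ∷ js ++ low f ∷ []) λ { (here u≡v) → u≢v u≡v })
          (lift-path-∷ʳ p (low∈ₑ f)))
        (proj₂ p)

  colour-surjective : Edge T → Surjective C colour
  colour-surjective e i with splitAt m i in split
  ... | inj₁ a = inj₁ a , splitAt⁻¹-↑ˡ split
  ... | inj₂ x = inj₂ (e , x) , splitAt⁻¹-↑ʳ split

  colour-locating : IsLocating C colour
  colour-locating u v u≢v with colour u ≟ᶠ colour v
  ... | no cu≢cv = colour u , own-colour-separates C cu≢cv
  colour-locating (inj₁ a) (inj₁ b) u≢v | yes same =
    ⊥-elim (u≢v (cong inj₁ (↑ˡ-injective n a b same)))
  colour-locating (inj₁ _) (inj₂ _) _ | yes same = ⊥-elim (base≢copy same)
  colour-locating (inj₂ _) (inj₁ _) _ | yes same = ⊥-elim (base≢copy (sym same))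
  colour-locating (inj₂ (e , x)) (inj₂ (f , y)) u≢v | yes same with ↑ʳ-injective m x y same
  ... | refl =
    let t , t∈e , t∉f = unshared-end {e} {f} (λ { refl → u≢v refl })
    in colour (inj₁ t) , lone-neighbour-separates C lone refl t∈e t∉f
    where
    lone : ∀ {t} z → colour z ≡ colour (inj₁ t) → z ≡ inj₁ t
    lone (inj₁ a) same′ = cong inj₁ (↑ˡ-injective n _ _ same′)
    lone (inj₂ _) same′ = ⊥-elim (base≢copy (sym same′))

m+n≤2m+n∸2 : ∀ m n → 2 ≤ m → m + n ≤ 2 * m + n ∸ 2
m+n≤2m+n∸2 (suc (suc k)) n (s≤s (s≤s _)) =
  subst (2 + k + n ≤_) (rearrange k n) (m≤m+n (2 + k + n) k)
  where
  -- The right-hand side is the normal form of 2 * (2 + k) + n ∸ 2.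
  rearrange : ∀ k n → 2 + k + n + k ≡ k + (2 + k + 0) + n
  rearrange = solve-∀

below-minimum⇒≤ : ∀ {P : ℕ → Set} {s r} →
  (∀ k → 1 ≤ k → k < s → ¬ P k) → 1 ≤ r → P r → s ≤ r
below-minimum⇒≤ {s = s} {r} minimal 1≤r pr with s ≤? r
... | yes s≤r = s≤r
... | no s≰r  = ⊥-elim (minimal r 1≤r (≰⇒> s≰r) pr)

mainTheorem6 : (m n : ℕ) → 2 ≤ m → 2 ≤ n →
    (T : Graph (Fin m)) → IsTree T →
    (s r : ℕ) → IsRvc T s → IsRvcl (T ⋄ K n) r →
    (s ⊔ (n + 2)) ≤ r × r ≤ (2 * m + n) ∸ 2
mainTheorem6 m n 2≤m _ T tree s r (_ , _ , rvc-minimal) (1≤r , (c , rb , sj , loc) , rvcl-minimal)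
  with leaf-exists T tree 2≤m
... | a , b , leaf = ⊔-lub s≤r n+2≤r , ≤-trans r≤m+n (m+n≤2m+n∸2 m n 2≤m)
  where
  open Edges T using (edge-through)
  open Corona T (K n) using (restriction-rainbow)
  open BaseCopyColouring T (K n) using (colour; colour-rainbow; colour-surjective; colour-locating)

  s≤r : s ≤ r
  s≤r = below-minimum⇒≤ rvc-minimal 1≤r (c ∘ inj₁ , restriction-rainbow rb)

  n+2≤r : n + 2 ≤ r
  n+2≤r = subst (_≤ r) (+-comm 2 n)
    (≰⇒> λ r≤n+1 → LeafClique.no-locating-colouring-below T leaf c r≤n+1 rb sj loc)

  r≤m+n : r ≤ m + n
  r≤m+n = below-minimum⇒≤ rvcl-minimal (≤-trans (s≤s z≤n) (≤-trans 2≤m (m≤m+n m n)))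
    (colour , colour-rainbow (proj₁ tree) , colour-surjective (proj₁ (edge-through (proj₁ leaf))) ,
     colour-locating)
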